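{- For all integers $n\ge 2$, $2\le k\le n$ and $1\le\ell\le n-1$, we have $s(n,k,\ell)=f(n,k,\ell)$ and $t(n,k,\ell)=g(n,k,\ell)$.
   Context: Digraphs have no loops or parallel arcs. An out-tree is an oriented tree in which every vertex except the root has in-degree one. For $S\subseteq V(D)$, $|S|\ge 2$, $r\in S$, an $(S,r)$-tree is an out-tree in $D$ rooted at $r$ whose vertex set contains $S$. Two $(S,r)$-trees are arc-disjoint if they share no arc, and internally disjoint if moreover their vertex sets intersect exactly in $S$. $\kappa_{S,r}(D)$ (resp. $\lambda_{S,r}(D)$) is the maximum number of pairwise internally disjoint (resp. arc-disjoint) $(S,r)$-trees; $\kappa_k(D)$ (resp. $\lambda_k(D)$) is the minimum of $\kappa_{S,r}(D)$ (resp. $\lambda_{S,r}(D)$) over all $S\subseteq V(D)$ with $|S|=k$ and all $r\in S$. $D$ is minimally generalized $(k,\ell)$-vertex-strongly (resp. arc-strongly) connected if $\kappa_k(D)\ge\ell$ (resp. $\lambda_k(D)\ge\ell$) but $\kappa_k(D-e)\le\ell-1$ (resp. $\lambda_k(D-e)\le\ell-1$) for every arc $e$. $f(n,k,\ell)$ (resp. $g(n,k,\ell)$) is the minimum number of arcs of a minimally generalized $(k,\ell)$-vertex-strongly (resp. arc-strongly) connected digraph of order $n$. $s(n,k,\ell)$ (resp. $t(n,k,\ell)$) is the minimum number of arcs of a strongly connected digraph $D$ of order $n$ with $\kappa_k(D)=\ell$ (resp. $\lambda_k(D)=\ell$). -}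

module Defs where

open import Data.Nat using (ℕ; zero; suc; _+_; _≤_)
open import Data.Bool using (Bool; true; false; _∧_; not; if_then_else_)
open import Data.Fin using (Fin; _≟_)
open import Data.Fin.Subset using (Subset; _∈_; _⊆_; ∣_∣)
open import Data.List using (List; map; allFin)
open import Data.Nat.ListAction using (sum)
open import Data.Product using (Σ; _×_; _,_)
open import Relation.Nullary using (¬_; ⌊_⌋)
open import Relation.Binary.PropositionalEquality using (_≡_; _≢_)

Digraph : ℕ → Set
Digraph n = Fin n → Fin n → Bool

-- no loops (parallel arcs are impossible in this representation)
Loopless : ∀ {n} → Digraph n → Set
Loopless {n} D = (i : Fin n) → D i i ≡ false

arcCount : ∀ {n} → Digraph n → ℕ
arcCount {n} D =
  sum (map (λ i → sum (map (λ j → if D i j then 1 else 0) (allFin n))) (allFin n))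

removeArc : ∀ {n} → Digraph n → Fin n → Fin n → Digraph n
removeArc D u v x y = D x y ∧ not (⌊ x ≟ u ⌋ ∧ ⌊ y ≟ v ⌋)

data Reach {n} (A : Digraph n) (x : Fin n) : Fin n → Set where
  here : Reach A x x
  step : ∀ {u v} → Reach A x u → A u v ≡ true → Reach A x v

StronglyConnected : ∀ {n} → Digraph n → Set
StronglyConnected {n} D = (u v : Fin n) → Reach D u v

record OutTree {n} (D : Digraph n) (r : Fin n) : Set where
  field
    verts   : Subset n
    arcs    : Digraph n
    arcsInD : ∀ u v → arcs u v ≡ true → D u v ≡ true
    arcEnds : ∀ u v → arcs u v ≡ true → (u ∈ verts) × (v ∈ verts)
    rootIn  : r ∈ verts
    rootIn0 : ∀ u → arcs u r ≡ false
    inDeg1  : ∀ v → v ∈ verts → v ≢ r →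
              Σ (Fin n) (λ u → (arcs u v ≡ true) × (∀ w → arcs w v ≡ true → w ≡ u))
    reach   : ∀ v → v ∈ verts → Reach arcs r v

open OutTree public

record SRTree {n} (D : Digraph n) (S : Subset n) (r : Fin n) : Set where
  field
    tree  : OutTree D r
    spans : S ⊆ verts tree

open SRTree public

ArcDisjoint : ∀ {n} {D : Digraph n} {S r} → SRTree D S r → SRTree D S r → Set
ArcDisjoint {n} T₁ T₂ =
  (u v : Fin n) → ¬ ((arcs (tree T₁) u v ≡ true) × (arcs (tree T₂) u v ≡ true))

InternallyDisjoint : ∀ {n} {D : Digraph n} {S r} → SRTree D S r → SRTree D S r → Set
InternallyDisjoint {n} {S = S} T₁ T₂ =
  ArcDisjoint T₁ T₂ ×
  ((v : Fin n) → v ∈ verts (tree T₁) → v ∈ verts (tree T₂) → v ∈ S)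

κSr≥ : ∀ {n} → Digraph n → Subset n → Fin n → ℕ → Set
κSr≥ {n} D S r ℓ =
  Σ (Fin ℓ → SRTree D S r) (λ T → ∀ i j → i ≢ j → InternallyDisjoint (T i) (T j))

λSr≥ : ∀ {n} → Digraph n → Subset n → Fin n → ℕ → Set
λSr≥ {n} D S r ℓ =
  Σ (Fin ℓ → SRTree D S r) (λ T → ∀ i j → i ≢ j → ArcDisjoint (T i) (T j))

κk≥ : ∀ {n} → Digraph n → ℕ → ℕ → Set
κk≥ {n} D k ℓ = (S : Subset n) (r : Fin n) → ∣ S ∣ ≡ k → r ∈ S → κSr≥ D S r ℓ

λk≥ : ∀ {n} → Digraph n → ℕ → ℕ → Set
λk≥ {n} D k ℓ = (S : Subset n) (r : Fin n) → ∣ S ∣ ≡ k → r ∈ S → λSr≥ D S r ℓ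

MinVertexConn : (n k ℓ : ℕ) → Digraph n → Set
MinVertexConn n k ℓ D =
  Loopless D × κk≥ D k ℓ ×
  (∀ u v → D u v ≡ true → ¬ κk≥ (removeArc D u v) k ℓ)

MinArcConn : (n k ℓ : ℕ) → Digraph n → Set
MinArcConn n k ℓ D =
  Loopless D × λk≥ D k ℓ ×
  (∀ u v → D u v ≡ true → ¬ λk≥ (removeArc D u v) k ℓ)

StrongκEq : (n k ℓ : ℕ) → Digraph n → Set
StrongκEq n k ℓ D =
  Loopless D × StronglyConnected D × κk≥ D k ℓ × ¬ κk≥ D k (suc ℓ)

StrongλEq : (n k ℓ : ℕ) → Digraph n → Set
StrongλEq n k ℓ D =
  Loopless D × StronglyConnected D × λk≥ D k ℓ × ¬ λk≥ D k (suc ℓ)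

IsMinArcs : (n : ℕ) → (Digraph n → Set) → ℕ → Set
IsMinArcs n P m =
  Σ (Digraph n) (λ D → P D × arcCount D ≡ m) × (∀ D → P D → m ≤ arcCount D)

IsS IsF IsT IsG : ℕ → ℕ → ℕ → ℕ → Set
IsS n k ℓ = IsMinArcs n (StrongκEq n k ℓ)
IsF n k ℓ = IsMinArcs n (MinVertexConn n k ℓ)
IsT n k ℓ = IsMinArcs n (StrongλEq n k ℓ)
IsG n k ℓ = IsMinArcs n (MinArcConn n k ℓ)

-- Both κ_k ≥ ℓ and λ_k ≥ ℓ are preserved by adding arcs, survive the deletion of one arc
-- when raised to ℓ + 1 (at most one of ℓ + 1 arc-disjoint trees uses that arc), and force
-- strong connectivity. Hence a minimal digraph with property ℓ cannot have property ℓ + 1,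
-- so it is a strong digraph with parameter exactly ℓ; conversely an arc-minimum strong
-- digraph with parameter exactly ℓ loses property ℓ under every arc deletion, since
-- otherwise the smaller digraph would again have parameter exactly ℓ. Every digraph with
-- property ℓ contains a minimal one, so both minima coincide.
module Submission where

open import Defs
open import Data.Nat using (ℕ; _≤_; _∸_)
open import Data.Product using (_×_)
open import Function.Bundles using (_⇔_)

open import Data.Nat using (suc; _+_; _<_; z≤n; s≤s; _≤?_)
open import Data.Nat.Properties
  using (≤-refl; ≤-trans; ≤-reflexive; <⇒≤; ≤⇒≯; ≰⇒>; ≤-antisym;
         m≤n⇒m≤1+n; +-suc; +-mono-≤; +-mono-<-≤; +-mono-≤-<)
open import Data.Nat.Induction using (<-wellFounded)
open import Induction.WellFounded using (Acc; acc)
open import Data.Bool using (Bool; true; false; if_then_else_)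
open import Data.Bool.Properties using (¬-not; ∧-zeroʳ) renaming (_≟_ to _≟ᵇ_)
open import Data.Fin using (Fin; zero; suc; _≟_; punchIn; fromℕ<)
open import Data.Fin.Properties using (any?; punchInᵢ≢i; punchIn-injective)
open import Data.Fin.Subset using (Subset; ⊤; ⁅_⁆; _∪_; inside; outside; ∣_∣; _∈_; _⊆_)
open import Data.Fin.Subset.Properties using (∣⊤∣≡n; ∣⁅x⁆∣≡1; ⊆⊤; x∈⁅x⁆; p⊆p∪q; q⊆p∪q)
open import Data.Vec using ([]; _∷_; here; there)
open import Data.List using (List; map; allFin) renaming ([] to []ₗ; _∷_ to _∷ₗ_)
open import Data.List.Relation.Unary.Any using () renaming (here to hereₗ; there to thereₗ)
open import Data.List.Membership.Propositional using () renaming (_∈_ to _∈ₗ_)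
open import Data.List.Membership.Propositional.Properties using (∈-allFin)
open import Data.Nat.ListAction using (sum)
open import Data.Product using (Σ; _,_; proj₁)
open import Data.Empty using (⊥)
open import Relation.Nullary using (¬_; yes; no; contradiction)
open import Relation.Nullary.Decidable using (decidable-stable; ¬¬-excluded-middle)
open import Relation.Binary.PropositionalEquality using (_≡_; _≢_; refl; sym; trans; cong; cong₂; subst)
open import Function using (_∘_; mk⇔)

∣p∪q∣≤∣p∣+∣q∣ : ∀ {n} (p q : Subset n) → ∣ p ∪ q ∣ ≤ ∣ p ∣ + ∣ q ∣
∣p∪q∣≤∣p∣+∣q∣ []            []            = z≤n
∣p∪q∣≤∣p∣+∣q∣ (outside ∷ p) (outside ∷ q) = ∣p∪q∣≤∣p∣+∣q∣ p q
∣p∪q∣≤∣p∣+∣q∣ (outside ∷ p) (inside ∷ q)  =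
  ≤-trans (s≤s (∣p∪q∣≤∣p∣+∣q∣ p q)) (≤-reflexive (sym (+-suc ∣ p ∣ ∣ q ∣)))
∣p∪q∣≤∣p∣+∣q∣ (inside ∷ p)  (outside ∷ q) = s≤s (∣p∪q∣≤∣p∣+∣q∣ p q)
∣p∪q∣≤∣p∣+∣q∣ (inside ∷ p)  (inside ∷ q)  =
  s≤s (≤-trans (m≤n⇒m≤1+n (∣p∪q∣≤∣p∣+∣q∣ p q)) (≤-reflexive (sym (+-suc ∣ p ∣ ∣ q ∣))))

∷-mono-⊆ : ∀ {n} {p q : Subset n} b → p ⊆ q → (b ∷ p) ⊆ (b ∷ q)
∷-mono-⊆ b p⊆q here      = here
∷-mono-⊆ b p⊆q (there x) = there (p⊆q x)

extend-to-size : ∀ {n k} (p : Subset n) → ∣ p ∣ ≤ k → k ≤ n →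
                 Σ (Subset n) (λ q → p ⊆ q × ∣ q ∣ ≡ k)
extend-to-size []            z≤n     z≤n = [] , (λ ()) , refl
extend-to-size (inside ∷ p)  (s≤s p≤k) (s≤s k≤n) with extend-to-size p p≤k k≤n
... | q , p⊆q , ∣q∣≡k = inside ∷ q , ∷-mono-⊆ inside p⊆q , cong suc ∣q∣≡k
extend-to-size {suc n} {k} (outside ∷ p) p≤k k≤1+n with k ≤? n
... | yes k≤n = let q , p⊆q , ∣q∣≡k = extend-to-size p p≤k k≤n
                in outside ∷ q , ∷-mono-⊆ outside p⊆q , ∣q∣≡k
... | no  k≰n = ⊤ , ⊆⊤ , trans (∣⊤∣≡n (suc n)) (≤-antisym (≰⇒> k≰n) k≤1+n)

pair-in-subset-of-size : ∀ {n k} → 2 ≤ k → k ≤ n → (u v : Fin n) →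
                         Σ (Subset n) (λ S → ∣ S ∣ ≡ k × u ∈ S × v ∈ S)
pair-in-subset-of-size {k = k} 2≤k k≤n u v =
  let S , ⊆S , ∣S∣≡k = extend-to-size (⁅ u ⁆ ∪ ⁅ v ⁆) ∣⁅u⁆∪⁅v⁆∣≤k k≤n
  in S , ∣S∣≡k , ⊆S (p⊆p∪q ⁅ v ⁆ (x∈⁅x⁆ u)) , ⊆S (q⊆p∪q ⁅ u ⁆ ⁅ v ⁆ (x∈⁅x⁆ v))
  where
  ∣⁅u⁆∪⁅v⁆∣≤k : ∣ ⁅ u ⁆ ∪ ⁅ v ⁆ ∣ ≤ k
  ∣⁅u⁆∪⁅v⁆∣≤k = ≤-trans (∣p∪q∣≤∣p∣+∣q∣ ⁅ u ⁆ ⁅ v ⁆)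
                        (subst (_≤ k) (sym (cong₂ _+_ (∣⁅x⁆∣≡1 u) (∣⁅x⁆∣≡1 v))) 2≤k)

infix 4 _⊑_

_⊑_ : ∀ {n} → Digraph n → Digraph n → Set
_⊑_ {n} D D′ = (a b : Fin n) → D a b ≡ true → D′ a b ≡ true

Reach-mono : ∀ {n} {D D′ : Digraph n} {x y} → D ⊑ D′ → Reach D x y → Reach D′ x y
Reach-mono D⊑D′ here        = here
Reach-mono D⊑D′ (step p ab) = step (Reach-mono D⊑D′ p) (D⊑D′ _ _ ab)

arc-of-strongly-connected : ∀ {n} {D : Digraph n} → 2 ≤ n → StronglyConnected D →
                            Σ (Fin n) (λ u → Σ (Fin n) (λ v → D u v ≡ true))
arc-of-strongly-connected (s≤s (s≤s z≤n)) sc with sc zero (suc zero)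
... | step {u} {v} _ uv = u , v , uv

removeArc-⊑ : ∀ {n} (D : Digraph n) u v → removeArc D u v ⊑ D
removeArc-⊑ D u v a b with D a b
... | true  = λ _ → refl
... | false = λ ()

removeArc-loopless : ∀ {n} {D : Digraph n} u v → Loopless D → Loopless (removeArc D u v)
removeArc-loopless {D = D} u v loopless i rewrite loopless i = refl

removeArc-removes : ∀ {n} (D : Digraph n) u v → removeArc D u v u v ≡ false
removeArc-removes D u v with u ≟ u | v ≟ v
... | yes _   | yes _   = ∧-zeroʳ (D u v)
removeArc-removes D u v | no u≢u | _       = contradiction refl u≢u
removeArc-removes D u v | yes _  | no v≢v  = contradiction refl v≢v

⊑-removeArc : ∀ {n} {A D : Digraph n} {u v} → A ⊑ D → A u v ≡ false → A ⊑ removeArc D u v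
⊑-removeArc {u = u} {v} A⊑D uv∉A a b ab∈A rewrite A⊑D a b ab∈A with a ≟ u | b ≟ v
... | yes refl | yes refl = contradiction (trans (sym ab∈A) uv∉A) λ ()
... | yes _    | no _     = refl
... | no _     | _        = refl

sum-map-mono-≤ : ∀ {A : Set} {f g : A → ℕ} → (∀ x → f x ≤ g x) →
                 (xs : List A) → sum (map f xs) ≤ sum (map g xs)
sum-map-mono-≤ f≤g []ₗ        = z≤n
sum-map-mono-≤ f≤g (x ∷ₗ xs) = +-mono-≤ (f≤g x) (sum-map-mono-≤ f≤g xs)

sum-map-mono-< : ∀ {A : Set} {f g : A → ℕ} → (∀ x → f x ≤ g x) →
                 ∀ {xs x} → x ∈ₗ xs → f x < g x → sum (map f xs) < sum (map g xs)
sum-map-mono-< f≤g {_ ∷ₗ xs} (hereₗ refl) fx<gx = +-mono-<-≤ fx<gx (sum-map-mono-≤ f≤g xs)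
sum-map-mono-< f≤g {y ∷ₗ _}  (thereₗ x∈xs) fx<gx =
  +-mono-≤-< (f≤g y) (sum-map-mono-< f≤g x∈xs fx<gx)

arcCount-< : ∀ {n} {D D′ : Digraph n} {u v} → D ⊑ D′ → D u v ≡ false → D′ u v ≡ true →
             arcCount D < arcCount D′
arcCount-< {n} {D} {D′} {u} {v} D⊑D′ uv∉D uv∈D′ =
  sum-map-mono-< (λ a → sum-map-mono-≤ (indicator-mono a) (allFin n)) (∈-allFin u)
    (sum-map-mono-< (indicator-mono u) (∈-allFin v) indicator-<)
  where
  indicator : Digraph n → Fin n → Fin n → ℕ
  indicator G a b = if G a b then 1 else 0

  indicator-mono : ∀ a b → indicator D a b ≤ indicator D′ a b
  indicator-mono a b with D a b in ab∈D
  ... | false = z≤n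
  ... | true rewrite D⊑D′ a b ab∈D = ≤-refl

  indicator-< : indicator D u v < indicator D′ u v
  indicator-< rewrite uv∉D | uv∈D′ = s≤s z≤n

arcCount-removeArc-< : ∀ {n} (D : Digraph n) {u v} → D u v ≡ true →
                       arcCount (removeArc D u v) < arcCount D
arcCount-removeArc-< D {u} {v} = arcCount-< (removeArc-⊑ D u v) (removeArc-removes D u v)

retarget : ∀ {n} {D D′ : Digraph n} {S r} (T : SRTree D S r) → arcs (tree T) ⊑ D′ →
           SRTree D′ S r
retarget T arcs⊑D′ = record
  { tree = record
    { verts   = verts (tree T)
    ; arcs    = arcs (tree T)
    ; arcsInD = arcs⊑D′
    ; arcEnds = arcEnds (tree T)
    ; rootIn  = rootIn (tree T)
    ; rootIn0 = rootIn0 (tree T)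
    ; inDeg1  = inDeg1 (tree T)
    ; reach   = reach (tree T) }
  ; spans = spans T }

false-except-one : ∀ {m} (P : Fin (suc m) → Bool) →
                   (∀ i j → i ≢ j → P i ≡ true → P j ≡ true → ⊥) →
                   Σ (Fin (suc m)) (λ i₀ → ∀ i → i ≢ i₀ → P i ≡ false)
false-except-one P at-most-once with any? (λ i → P i ≟ᵇ true)
... | yes (i₀ , Pi₀) = i₀ , λ i i≢i₀ → ¬-not λ Pi → at-most-once i i₀ i≢i₀ Pi Pi₀
... | no  none       = zero , λ i _ → ¬-not λ Pi → none (i , Pi)

-- Disj stands for ArcDisjoint or InternallyDisjoint; Packs D k ℓ is then λk≥ D k ℓ or κk≥ D k ℓ.
module Packing
  (Disj : ∀ {n} {D : Digraph n} {S r} → SRTree D S r → SRTree D S r → Set)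
  (Disj⇒ArcDisjoint : ∀ {n} {D : Digraph n} {S r} {T T′ : SRTree D S r} →
                      Disj T T′ → ArcDisjoint T T′)
  (Disj-retarget : ∀ {n} {D D′ : Digraph n} {S r} {T T′ : SRTree D S r}
                   {p : arcs (tree T) ⊑ D′} {p′ : arcs (tree T′) ⊑ D′} →
                   Disj T T′ → Disj (retarget T p) (retarget T′ p′))
  where

  Packs : ∀ {n} → Digraph n → ℕ → ℕ → Set
  Packs {n} D k ℓ = (S : Subset n) (r : Fin n) → ∣ S ∣ ≡ k → r ∈ S →
    Σ (Fin ℓ → SRTree D S r) (λ T → ∀ i j → i ≢ j → Disj (T i) (T j))

  Packs-mono : ∀ {n} {D D′ : Digraph n} {k ℓ} → D ⊑ D′ → Packs D k ℓ → Packs D′ k ℓ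
  Packs-mono D⊑D′ packs S r ∣S∣≡k r∈S =
    let T , disjoint = packs S r ∣S∣≡k r∈S
    in (λ i → retarget (T i) (λ a b → D⊑D′ a b ∘ arcsInD (tree (T i)) a b))
     , λ i j i≢j → Disj-retarget (disjoint i j i≢j)

  Packs-removeArc : ∀ {n} {D : Digraph n} {k ℓ} u v →
                    Packs D k (suc ℓ) → Packs (removeArc D u v) k ℓ
  Packs-removeArc u v packs S r ∣S∣≡k r∈S
    with packs S r ∣S∣≡k r∈S
  ... | T , disjoint
    with false-except-one (λ i → arcs (tree (T i)) u v)
           (λ i j i≢j uv∈Tᵢ uv∈Tⱼ → Disj⇒ArcDisjoint (disjoint i j i≢j) u v (uv∈Tᵢ , uv∈Tⱼ))
  ... | i₀ , uv∉T =
    (λ i → retarget (T (punchIn i₀ i))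
             (⊑-removeArc (arcsInD (tree (T (punchIn i₀ i)))) (uv∉T _ (punchInᵢ≢i i₀ i))))
    , λ i j i≢j → Disj-retarget (disjoint _ _ (i≢j ∘ punchIn-injective i₀ i j))

  Packs⇒strongly-connected : ∀ {n} {D : Digraph n} {k ℓ} → 2 ≤ k → k ≤ n → 1 ≤ ℓ →
                             Packs D k ℓ → StronglyConnected D
  Packs⇒strongly-connected 2≤k k≤n 1≤ℓ packs u v =
    let S , ∣S∣≡k , u∈S , v∈S = pair-in-subset-of-size 2≤k k≤n u v
        T = proj₁ (packs S u ∣S∣≡k u∈S) (fromℕ< 1≤ℓ)
    in Reach-mono (arcsInD (tree T)) (reach (tree T) v (spans T v∈S))

module ExactVersusMinimal {n : ℕ} (C : Digraph n → ℕ → Set)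
  (C-mono : ∀ {D D′ j} → D ⊑ D′ → C D j → C D′ j)
  (C-removeArc : ∀ {D j} u v → C D (suc j) → C (removeArc D u v) j)
  (C⇒strongly-connected : ∀ {D j} → 1 ≤ j → C D j → StronglyConnected D)
  (2≤n : 2 ≤ n) (ℓ : ℕ) (1≤ℓ : 1 ≤ ℓ)
  where

  Exact Minimal : Digraph n → Set
  Exact D   = Loopless D × StronglyConnected D × C D ℓ × ¬ C D (suc ℓ)
  Minimal D = Loopless D × C D ℓ × (∀ u v → D u v ≡ true → ¬ C (removeArc D u v) ℓ)

  DeletableArc : Digraph n → Set
  DeletableArc D = Σ (Fin n) λ u → Σ (Fin n) λ v → D u v ≡ true × C (removeArc D u v) ℓ

  minimal⇒exact : ∀ {D} → Minimal D → Exact D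
  minimal⇒exact (loopless , c , minimal) =
    loopless , strong , c ,
    λ c₊ → let u , v , uv = arc-of-strongly-connected 2≤n strong
           in minimal u v uv (C-removeArc u v c₊)
    where strong = C⇒strongly-connected 1≤ℓ c

  -- Whether some arc can be deleted is not decidable, so the descent only yields a ¬¬;
  -- this suffices because it is only used to prove a (decidable) inequality.
  minimal-below : ∀ D → Acc _<_ (arcCount D) → Loopless D → C D ℓ →
                  ¬ ¬ Σ (Digraph n) (λ D′ → Minimal D′ × arcCount D′ ≤ arcCount D)
  minimal-below D (acc smaller) loopless c none-below = ¬¬-excluded-middle {A = DeletableArc D} λ where
    (yes (u , v , uv , c′)) →
      let fewer = arcCount-removeArc-< D uv
      in minimal-below (removeArc D u v) (smaller fewer) (removeArc-loopless {D = D} u v loopless) c′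
           λ (D′ , minimal , ≤D-uv) → none-below (D′ , minimal , ≤-trans ≤D-uv (<⇒≤ fewer))
    (no no-deletable) →
      none-below (D , (loopless , c , λ u v uv c′ → no-deletable (u , v , uv , c′)) , ≤-refl)

  exact-minimum⇒minimal : ∀ m → IsMinArcs n Exact m → IsMinArcs n Minimal m
  exact-minimum⇒minimal m ((D , (loopless , _ , c , ¬c₊) , ∣D∣≡m) , minimum) =
    (D , (loopless , c , deletion-destroys) , ∣D∣≡m) , λ D′ → minimum D′ ∘ minimal⇒exact
    where
    deletion-destroys : ∀ u v → D u v ≡ true → ¬ C (removeArc D u v) ℓ
    deletion-destroys u v uv c′ = ≤⇒≯
      (minimum (removeArc D u v)
        ( removeArc-loopless {D = D} u v loopless , C⇒strongly-connected 1≤ℓ c′ , c′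
        , ¬c₊ ∘ C-mono (removeArc-⊑ D u v)))
      (subst (arcCount (removeArc D u v) <_) ∣D∣≡m (arcCount-removeArc-< D uv))

  minimal-minimum⇒exact : ∀ m → IsMinArcs n Minimal m → IsMinArcs n Exact m
  minimal-minimum⇒exact m ((D , minimal , ∣D∣≡m) , minimum) =
    (D , minimal⇒exact minimal , ∣D∣≡m) , below-exact
    where
    below-exact : ∀ D′ → Exact D′ → m ≤ arcCount D′
    below-exact D′ (loopless , _ , c , _) = decidable-stable (m ≤? arcCount D′) λ m≰ →
      minimal-below D′ (<-wellFounded _) loopless c
        λ (D″ , minimal″ , ≤D′) → m≰ (≤-trans (minimum D″ minimal″) ≤D′)

  exact-minimum⇔minimal-minimum : ∀ m → IsMinArcs n Exact m ⇔ IsMinArcs n Minimal m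
  exact-minimum⇔minimal-minimum m = mk⇔ (exact-minimum⇒minimal m) (minimal-minimum⇒exact m)

lemma3p2 : (n k ℓ : ℕ) → 2 ≤ n → 2 ≤ k → k ≤ n → 1 ≤ ℓ → ℓ ≤ n ∸ 1 →
    ((m : ℕ) → IsS n k ℓ m ⇔ IsF n k ℓ m) × ((m : ℕ) → IsT n k ℓ m ⇔ IsG n k ℓ m)
lemma3p2 n k ℓ 2≤n 2≤k k≤n 1≤ℓ _ =
  ExactVersusMinimal.exact-minimum⇔minimal-minimum (λ D j → κk≥ D k j)
    Vertex.Packs-mono Vertex.Packs-removeArc (Vertex.Packs⇒strongly-connected 2≤k k≤n) 2≤n ℓ 1≤ℓ
  , ExactVersusMinimal.exact-minimum⇔minimal-minimum (λ D j → λk≥ D k j)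
    Arc.Packs-mono Arc.Packs-removeArc (Arc.Packs⇒strongly-connected 2≤k k≤n) 2≤n ℓ 1≤ℓ
  where
  module Vertex = Packing InternallyDisjoint proj₁ (λ disjoint → disjoint)
  module Arc    = Packing ArcDisjoint (λ disjoint → disjoint) (λ disjoint → disjoint)
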